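{- Let $V,W$ be finite sets, $\mathcal{A}\subseteq[n]^V$, $\mathcal{B}\subseteq[n]^W$, $S^-\subseteq S\subseteq S^+\subseteq V$ and $T\subseteq W$. Then (a) $\mu_{S^+}(\mathcal{A})\le\mu_S(\mathcal{A})\le\mu_S(\mathrm{proj}_{S^+}(\mathcal{A}))\le\pi_S(\mathcal{A})\le\pi_{S^- }(\mathcal{A})$; (b) $\delta(\mathcal{A})\le\pi_S(\mathcal{A})\cdot\mu_{V\setminus S}(\mathcal{A})$; (c) $\delta(\mathcal{A}\bowtie\mathcal{B})\le\pi_S(\mathcal{A})\cdot\mu_{T\setminus S}(\mathrm{proj}_T(\mathcal{B}))\cdot\mu_{(V\cup W)\setminus(S\cup T)}(\mathcal{A}\bowtie\mathcal{B})$.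
   Context: $[n]^V$ is the set of maps $V\to[n]$, with $[n]^\emptyset=\{()\}$; for $x\in[n]^V$ and $S\subseteq V$, $x_S$ is the restriction; for disjoint sets, $yz$ is the common extension. For $\mathcal{A}\subseteq[n]^V$: $\delta(\mathcal{A})=|\mathcal{A}|/n^{|V|}$; $\mathrm{proj}_S(\mathcal{A})=\{x_S:x\in\mathcal{A}\}$ and $\pi_S(\mathcal{A})=|\mathrm{proj}_S(\mathcal{A})|/n^{|S|}$; for $z\in[n]^{V\setminus S}$, $\mathcal{A}|^z_S=\{y\in[n]^S:yz\in\mathcal{A}\}$ and $\mu_S(\mathcal{A})=\max_z|\mathcal{A}|^z_S|/n^{|S|}$. More generally, for a set $S$ not contained in the index set $U$ of a relation $\mathcal{C}\subseteq[n]^U$, $\mu_S(\mathcal{C})$ means $\mu_{S\cap U}(\mathcal{C})$. The join of $\mathcal{A}\subseteq[n]^V$, $\mathcal{B}\subseteq[n]^W$ is $\mathcal{A}\bowtie\mathcal{B}=\{x\in[n]^{V\cup W}:x_V\in\mathcal{A},x_W\in\mathcal{B}\}$. -}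

module Defs where

open import Data.Nat using (ℕ; zero; suc; _^_; _⊔_; NonZero)
open import Data.Nat.Properties using (m^n≢0)
open import Data.Bool using (Bool; true; false; _∧_; if_then_else_)
open import Data.Fin using (Fin; _≟_)
open import Data.Maybe using (Maybe; just; nothing)
open import Data.List using (List; []; _∷_; map; concatMap; allFin; foldr)
open import Data.Vec using (Vec; []; _∷_)
open import Data.Fin.Subset using (Subset; _∩_; _─_; ∣_∣)
open import Data.Integer using (+_)
open import Data.Rational using (ℚ; _/_)
open import Relation.Nullary.Decidable using (⌊_⌋)

-- Variables range over a common finite universe Fin k; a finite set of
-- variables V is a Subset k.  A point of [n]^V is encoded as a vector
-- x : Vec (Maybe (Fin n)) k whose defined entries are exactly those in V.
Pt : ℕ → ℕ → Set
Pt n k = Vec (Maybe (Fin n)) k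

points : (n : ℕ) {k : ℕ} → Subset k → List (Pt n k)
points n []          = [] ∷ []
points n (true ∷ V)  = concatMap (λ a → map (just a ∷_) (points n V)) (allFin n)
points n (false ∷ V) = map (nothing ∷_) (points n V)

eqM : {n : ℕ} → Maybe (Fin n) → Maybe (Fin n) → Bool
eqM nothing  nothing  = true
eqM (just a) (just b) = ⌊ a ≟ b ⌋
eqM _        _        = false

eqPt : {n k : ℕ} → Pt n k → Pt n k → Bool
eqPt []       []       = true
eqPt (a ∷ x)  (b ∷ y)  = eqM a b ∧ eqPt x y

any : {A : Set} → (A → Bool) → List A → Bool
any p []       = false
any p (x ∷ xs) = if p x then true else any p xs

countB : {A : Set} → (A → Bool) → List A → ℕ
countB p []       = 0
countB p (x ∷ xs) = if p x then suc (countB p xs) else countB p xs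

maxList : List ℕ → ℕ
maxList = foldr _⊔_ 0

restrict : {n k : ℕ} → Subset k → Pt n k → Pt n k
restrict []          []      = []
restrict (true ∷ S)  (a ∷ x) = a ∷ restrict S x
restrict (false ∷ S) (a ∷ x) = nothing ∷ restrict S x

-- Common extension yz of points with disjoint domains.
ext : {n k : ℕ} → Pt n k → Pt n k → Pt n k
ext []             []      = []
ext (just a ∷ y)   (b ∷ z) = just a ∷ ext y z
ext (nothing ∷ y)  (b ∷ z) = b ∷ ext y z

-- A relation A ⊆ [n]^V: V = dom A, and A = { x ∈ [n]^V : mem A x ≡ true }.
record Rel (n k : ℕ) : Set where
  constructor rel
  field
    dom : Subset k
    mem : Pt n k → Bool
open Rel public

card : {n k : ℕ} → Rel n k → ℕ
card {n} A = countB (mem A) (points n (dom A))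

δ : {n k : ℕ} .{{_ : NonZero n}} → Rel n k → ℚ
δ {n} A = _/_ (+ card A) (n ^ ∣ dom A ∣) {{m^n≢0 n ∣ dom A ∣}}

proj : {n k : ℕ} → Subset k → Rel n k → Rel n k
proj {n} S A = rel S (λ y → any (λ x → mem A x ∧ eqPt (restrict S x) y) (points n (dom A)))

π : {n k : ℕ} .{{_ : NonZero n}} → Subset k → Rel n k → ℚ
π S A = δ (proj S A)

fiber : {n k : ℕ} → Subset k → Rel n k → Pt n k → Rel n k
fiber S A z = rel S (λ y → mem A (ext y z))

-- μ_S(A) = max_z |A|^z_{S'}| / n^|S'|  where S' = S ∩ V (the convention
-- μ_S(C) = μ_{S∩U}(C) for S not contained in the index set U of C).
μ : {n k : ℕ} .{{_ : NonZero n}} → Subset k → Rel n k → ℚ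
μ {n} S A =
  _/_ (+ maxList (map (λ z → card (fiber S' A z)) (points n (dom A ─ S'))))
      (n ^ ∣ S' ∣) {{m^n≢0 n ∣ S' ∣}}
  where S' = S ∩ dom A

open import Data.Fin.Subset using (_∪_)
join : {n k : ℕ} → Rel n k → Rel n k → Rel n k
join A B = rel (dom A ∪ dom B) (λ x → mem A (restrict (dom A) x) ∧ mem B (restrict (dom B) x))

module Submission where

-- Everything is reduced to counting points of [n]^V.  The one combinatorial
-- principle is the fibre bound (count-by-fibres): if V is the disjoint union
-- of X and Y, every fibre { y ∈ [n]^X : p (yz) } over z ∈ [n]^Y has at most
-- m elements, and the fibre over z is empty unless q z holds, then
--   |{ x ∈ [n]^V : p x }| ≤ m · |{ z ∈ [n]^Y : q z }|.
-- It is Fubini for the enumeration of [n]^V plus a pointwise bound.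

open import Data.Nat using (ℕ; NonZero)

module Fractions where

  open import Data.Nat using (suc)
  import Data.Nat as ℕ
  import Data.Nat.Properties as ℕ
  open import Data.Integer using (+_; +≤+)
  import Data.Integer as ℤ
  import Data.Integer.Properties as ℤ
  open import Data.Rational using (ℚ; _/_; _≤_; _*_; toℚᵘ)
  open import Data.Rational.Properties
    using (toℚᵘ-fromℚᵘ; toℚᵘ-injective; toℚᵘ-homo-*; toℚᵘ-cancel-≤)
  open import Data.Rational.Unnormalised using (mkℚᵘ; *≤*)
    renaming (_≃_ to _≃ᵘ_; _≤_ to _≤ᵘ_; _/_ to _/ᵘ_; _*_ to _*ᵘ_)
  import Data.Rational.Unnormalised.Properties as ℚᵘ
  open import Relation.Binary.PropositionalEquality

  frac : ℕ → (d : ℕ) → .{{NonZero d}} → ℚ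
  frac a d = (+ a) / d

  frac-toℚᵘ : ∀ a d .{{_ : NonZero d}} → toℚᵘ (frac a d) ≃ᵘ ((+ a) /ᵘ d)
  frac-toℚᵘ a (suc d) = toℚᵘ-fromℚᵘ (mkℚᵘ (+ a) d)

  frac-cong : ∀ a {b d} .{{_ : NonZero b}} .{{_ : NonZero d}} → b ≡ d → frac a b ≡ frac a d
  frac-cong a refl = refl

  fracᵘ-* : ∀ a b c d .{{_ : NonZero b}} .{{_ : NonZero d}} →
    ((+ a) /ᵘ b) *ᵘ ((+ c) /ᵘ d) ≃ᵘ ((+ (a ℕ.* c)) /ᵘ (b ℕ.* d)) {{ℕ.m*n≢0 b d}}
  fracᵘ-* a (suc b) c (suc d) =
    ℚᵘ.≃-reflexive (cong (λ x → mkℚᵘ x _) (sym (ℤ.pos-* a c)))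

  frac-* : ∀ a b c d .{{_ : NonZero b}} .{{_ : NonZero d}} →
    frac a b * frac c d ≡ frac (a ℕ.* c) (b ℕ.* d) {{ℕ.m*n≢0 b d}}
  frac-* a b c d = toℚᵘ-injective (begin
    toℚᵘ (frac a b * frac c d)                     ≈⟨ toℚᵘ-homo-* (frac a b) (frac c d) ⟩
    toℚᵘ (frac a b) *ᵘ toℚᵘ (frac c d)             ≈⟨ ℚᵘ.*-cong (frac-toℚᵘ a b) (frac-toℚᵘ c d) ⟩
    ((+ a) /ᵘ b) *ᵘ ((+ c) /ᵘ d)                   ≈⟨ fracᵘ-* a b c d ⟩
    ((+ (a ℕ.* c)) /ᵘ (b ℕ.* d)) {{ℕ.m*n≢0 b d}}   ≈⟨ ℚᵘ.≃-sym (frac-toℚᵘ (a ℕ.* c) (b ℕ.* d) {{ℕ.m*n≢0 b d}}) ⟩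
    toℚᵘ (frac (a ℕ.* c) (b ℕ.* d) {{ℕ.m*n≢0 b d}}) ∎)
    where open import Relation.Binary.Reasoning.Setoid ℚᵘ.≃-setoid

  fracᵘ-≤ : ∀ a b c d .{{_ : NonZero b}} .{{_ : NonZero d}} →
    a ℕ.* d ℕ.≤ c ℕ.* b → ((+ a) /ᵘ b) ≤ᵘ ((+ c) /ᵘ d)
  fracᵘ-≤ a (suc b) c (suc d) h =
    *≤* (subst₂ ℤ._≤_ (ℤ.pos-* a (suc d)) (ℤ.pos-* c (suc b)) (+≤+ h))

  frac-≤ : ∀ a b c d .{{_ : NonZero b}} .{{_ : NonZero d}} →
    a ℕ.* d ℕ.≤ c ℕ.* b → frac a b ≤ frac c d
  frac-≤ a b c d h = toℚᵘ-cancel-≤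
    (ℚᵘ.≤-respˡ-≃ (ℚᵘ.≃-sym (frac-toℚᵘ a b))
      (ℚᵘ.≤-respʳ-≃ (ℚᵘ.≃-sym (frac-toℚᵘ c d)) (fracᵘ-≤ a b c d h)))

module Sums where

  open import Data.Nat using (suc; _+_; _*_; _≤_; z≤n)
  open import Data.Nat.Properties
    using (+-assoc; +-mono-≤; *-zeroʳ; *-distribˡ-+; +-commutativeSemigroup; ≤-trans; m≤m⊔n; m≤n⊔m; ⊔-lub)
  open import Data.Bool using (Bool; true; false)
  open import Data.List using (List; []; _∷_; map; concatMap; _++_; length)
  open import Algebra.Properties.CommutativeSemigroup +-commutativeSemigroup using (interchange)
  open import Relation.Binary.PropositionalEquality
  open import Data.List.Membership.Propositional using (_∈_)
  open import Data.List.Relation.Unary.Any using (here; there)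
  open import Defs using (countB; maxList)

  Σ : {A : Set} → List A → (A → ℕ) → ℕ
  Σ []       f = 0
  Σ (x ∷ xs) f = f x + Σ xs f

  Σ-cong : {A : Set} (xs : List A) {f g : A → ℕ} → (∀ x → f x ≡ g x) → Σ xs f ≡ Σ xs g
  Σ-cong []       f≡g = refl
  Σ-cong (x ∷ xs) f≡g = cong₂ _+_ (f≡g x) (Σ-cong xs f≡g)

  Σ-mono : {A : Set} (xs : List A) {f g : A → ℕ} → (∀ x → f x ≤ g x) → Σ xs f ≤ Σ xs g
  Σ-mono []       f≤g = z≤n
  Σ-mono (x ∷ xs) f≤g = +-mono-≤ (f≤g x) (Σ-mono xs f≤g)

  Σ-++ : {A : Set} (xs ys : List A) (f : A → ℕ) → Σ (xs ++ ys) f ≡ Σ xs f + Σ ys f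
  Σ-++ []       ys f = refl
  Σ-++ (x ∷ xs) ys f = trans (cong (f x +_) (Σ-++ xs ys f)) (sym (+-assoc (f x) _ _))

  Σ-map : {A B : Set} (g : A → B) (xs : List A) (f : B → ℕ) → Σ (map g xs) f ≡ Σ xs (λ x → f (g x))
  Σ-map g []       f = refl
  Σ-map g (x ∷ xs) f = cong (f (g x) +_) (Σ-map g xs f)

  Σ-concatMap : {A B : Set} (g : A → List B) (xs : List A) (f : B → ℕ) →
    Σ (concatMap g xs) f ≡ Σ xs (λ x → Σ (g x) f)
  Σ-concatMap g []       f = refl
  Σ-concatMap g (x ∷ xs) f =
    trans (Σ-++ (g x) (concatMap g xs) f) (cong (Σ (g x) f +_) (Σ-concatMap g xs f))

  Σ-+ : {A : Set} (xs : List A) (f g : A → ℕ) → Σ xs (λ x → f x + g x) ≡ Σ xs f + Σ xs g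
  Σ-+ []       f g = refl
  Σ-+ (x ∷ xs) f g = trans (cong (f x + g x +_) (Σ-+ xs f g)) (interchange (f x) (g x) (Σ xs f) (Σ xs g))

  Σ-zero : {A : Set} (xs : List A) → Σ xs (λ _ → 0) ≡ 0
  Σ-zero []       = refl
  Σ-zero (x ∷ xs) = Σ-zero xs

  Σ-swap : {A B : Set} (xs : List A) (ys : List B) (f : A → B → ℕ) →
    Σ xs (λ x → Σ ys (f x)) ≡ Σ ys (λ y → Σ xs (λ x → f x y))
  Σ-swap []       ys f = sym (Σ-zero ys)
  Σ-swap (x ∷ xs) ys f =
    trans (cong (Σ ys (f x) +_) (Σ-swap xs ys f)) (sym (Σ-+ ys (f x) (λ y → Σ xs (λ x′ → f x′ y))))

  Σ-*ˡ : {A : Set} (xs : List A) (c : ℕ) (f : A → ℕ) → Σ xs (λ x → c * f x) ≡ c * Σ xs f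
  Σ-*ˡ []       c f = sym (*-zeroʳ c)
  Σ-*ˡ (x ∷ xs) c f = trans (cong (c * f x +_) (Σ-*ˡ xs c f)) (sym (*-distribˡ-+ c (f x) (Σ xs f)))

  Σ-const : {A : Set} (xs : List A) (c : ℕ) → Σ xs (λ _ → c) ≡ length xs * c
  Σ-const []       c = refl
  Σ-const (x ∷ xs) c = cong (c +_) (Σ-const xs c)

  ⟦_⟧ : Bool → ℕ
  ⟦ true ⟧  = 1
  ⟦ false ⟧ = 0

  countB-as-Σ : {A : Set} (p : A → Bool) (xs : List A) → countB p xs ≡ Σ xs (λ x → ⟦ p x ⟧)
  countB-as-Σ p []       = refl
  countB-as-Σ p (x ∷ xs) with p x
  ... | true  = cong suc (countB-as-Σ p xs)
  ... | false = countB-as-Σ p xs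

  maxList-≥ : {A : Set} (f : A → ℕ) {x : A} {xs : List A} → x ∈ xs → f x ≤ maxList (map f xs)
  maxList-≥ f {xs = y ∷ xs} (here refl)  = m≤m⊔n (f y) _
  maxList-≥ f {xs = y ∷ xs} (there x∈xs) = ≤-trans (maxList-≥ f x∈xs) (m≤n⊔m (f y) _)

  maxList-≤ : {A : Set} (f : A → ℕ) (xs : List A) {b : ℕ} →
    (∀ x → x ∈ xs → f x ≤ b) → maxList (map f xs) ≤ b
  maxList-≤ f []       bound = z≤n
  maxList-≤ f (y ∷ xs) bound =
    ⊔-lub (bound y (here refl)) (maxList-≤ f xs (λ x x∈xs → bound x (there x∈xs)))

module Booleans where

  open import Data.Bool using (Bool; true; false; _∧_)
  open import Data.List using (List; _∷_)
  open import Data.List.Membership.Propositional using (_∈_)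
  open import Data.List.Relation.Unary.Any using (here; there)
  open import Data.Product using (Σ-syntax; _×_; _,_)
  open import Relation.Binary.PropositionalEquality
  open import Defs using (any)

  ∧-intro : ∀ {a b} → a ≡ true → b ≡ true → a ∧ b ≡ true
  ∧-intro refl refl = refl

  ∧-elimˡ : ∀ {a b} → a ∧ b ≡ true → a ≡ true
  ∧-elimˡ {true} _ = refl

  ∧-elimʳ : ∀ a {b} → a ∧ b ≡ true → b ≡ true
  ∧-elimʳ true b≡true = b≡true

  any-intro : {A : Set} (p : A → Bool) {x : A} {xs : List A} → x ∈ xs → p x ≡ true → any p xs ≡ true
  any-intro p {xs = y ∷ xs} (here refl) px rewrite px = refl
  any-intro p {xs = y ∷ xs} (there x∈xs) px with p y
  ... | true  = refl
  ... | false = any-intro p x∈xs px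

  any-elim : {A : Set} (p : A → Bool) (xs : List A) → any p xs ≡ true → Σ[ x ∈ A ] (x ∈ xs × p x ≡ true)
  any-elim p (y ∷ xs) h with p y in py
  ... | true  = y , here refl , py
  ... | false with any-elim p xs h
  ... | x , x∈xs , px = x , there x∈xs , px

module Subsets where

  open import Data.Nat using (suc; _+_)
  open import Data.Bool using (true; false)
  open import Data.Vec using ([]; _∷_; here)
  open import Data.Fin.Subset using (Subset; _⊆_; _∩_; _∪_; _─_; ∣_∣)
  open import Data.Nat.Properties using (+-suc)
  open import Data.Fin.Subset.Properties using (⊆-refl; drop-∷-⊆; ∩-comm; p⊆p∪q; q⊆p∪q)
  open import Relation.Binary.PropositionalEquality

  -- Structural inclusion of subsets, position by position; it is equivalent
  -- to ⊆ and is the form on which the lemmas below recurse.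
  infix 4 _⊑_
  data _⊑_ : {k : ℕ} → Subset k → Subset k → Set where
    []   : [] ⊑ []
    skip : ∀ {k b} {X Y : Subset k} → X ⊑ Y → (false ∷ X) ⊑ (b ∷ Y)
    take : ∀ {k} {X Y : Subset k} → X ⊑ Y → (true ∷ X) ⊑ (true ∷ Y)

  ⊆⇒⊑ : ∀ {k} {X Y : Subset k} → X ⊆ Y → X ⊑ Y
  ⊆⇒⊑ {X = []}        {[]}    X⊆Y = []
  ⊆⇒⊑ {X = false ∷ X} {b ∷ Y} X⊆Y = skip (⊆⇒⊑ (drop-∷-⊆ X⊆Y))
  ⊆⇒⊑ {X = true ∷ X}  {b ∷ Y} X⊆Y with X⊆Y here
  ... | here = take (⊆⇒⊑ (drop-∷-⊆ X⊆Y))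

  ⊑-refl : ∀ {k} {X : Subset k} → X ⊑ X
  ⊑-refl = ⊆⇒⊑ ⊆-refl

  ⊑-trans : ∀ {k} {X Y Z : Subset k} → X ⊑ Y → Y ⊑ Z → X ⊑ Z
  ⊑-trans []       []       = []
  ⊑-trans (skip s) (skip t) = skip (⊑-trans s t)
  ⊑-trans (skip s) (take t) = skip (⊑-trans s t)
  ⊑-trans (take s) (take t) = take (⊑-trans s t)

  ∪-least : ∀ {k} {S T Z : Subset k} → S ⊑ Z → T ⊑ Z → S ∪ T ⊑ Z
  ∪-least []       []       = []
  ∪-least (skip s) (skip t) = skip (∪-least s t)
  ∪-least (skip s) (take t) = take (∪-least s t)
  ∪-least (take s) (skip t) = take (∪-least s t)
  ∪-least (take s) (take t) = take (∪-least s t)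

  ∪-mono : ∀ {k} {S T V W : Subset k} → S ⊑ V → T ⊑ W → S ∪ T ⊑ V ∪ W
  ∪-mono {V = V} {W} S⊑V T⊑W =
    ∪-least (⊑-trans S⊑V (⊆⇒⊑ (p⊆p∪q W))) (⊑-trans T⊑W (⊆⇒⊑ (q⊆p∪q V W)))

  data Split : {k : ℕ} → Subset k → Subset k → Subset k → Set where
    []    : Split [] [] []
    left  : ∀ {k} {V X Y : Subset k} → Split V X Y → Split (true ∷ V) (true ∷ X) (false ∷ Y)
    right : ∀ {k} {V X Y : Subset k} → Split V X Y → Split (true ∷ V) (false ∷ X) (true ∷ Y)
    none  : ∀ {k} {V X Y : Subset k} → Split V X Y → Split (false ∷ V) (false ∷ X) (false ∷ Y)

  split-swap : ∀ {k} {V X Y : Subset k} → Split V X Y → Split V Y X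
  split-swap []        = []
  split-swap (left s)  = right (split-swap s)
  split-swap (right s) = left (split-swap s)
  split-swap (none s)  = none (split-swap s)

  split-─ : ∀ {k} {X V : Subset k} → X ⊑ V → Split V X (V ─ X)
  split-─ []                  = []
  split-─ (skip {b = true} s)  = right (split-─ s)
  split-─ (skip {b = false} s) = none (split-─ s)
  split-─ (take s)             = left (split-─ s)

  split-∪ : ∀ {k} (S T : Subset k) → Split (S ∪ T) (T ─ S) S
  split-∪ []          []          = []
  split-∪ (true ∷ S)  (_ ∷ T)     = right (split-∪ S T)
  split-∪ (false ∷ S) (true ∷ T)  = left (split-∪ S T)
  split-∪ (false ∷ S) (false ∷ T) = none (split-∪ S T)

  split-nested : ∀ {k} {S S⁺ V : Subset k} → S ⊑ S⁺ → S⁺ ⊑ V → Split (V ─ S) (S⁺ ─ S) (V ─ S⁺)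
  split-nested []                  []                  = []
  split-nested (take s)            (take t)            = none (split-nested s t)
  split-nested (skip {b = true} s) (take t)            = left (split-nested s t)
  split-nested (skip {b = false} s) (skip {b = true} t)  = right (split-nested s t)
  split-nested (skip {b = false} s) (skip {b = false} t) = none (split-nested s t)

  split-size : ∀ {k} {V X Y : Subset k} → Split V X Y → ∣ V ∣ ≡ ∣ X ∣ + ∣ Y ∣
  split-size []        = refl
  split-size (left s)  = cong suc (split-size s)
  split-size {X = X} (right s) = trans (cong suc (split-size s)) (sym (+-suc ∣ X ∣ _))
  split-size (none s)  = split-size s

  ∩-absorb : ∀ {k} {X Y : Subset k} → X ⊑ Y → X ∩ Y ≡ X
  ∩-absorb []       = refl
  ∩-absorb (skip s) = cong (false ∷_) (∩-absorb s)
  ∩-absorb (take s) = cong (true ∷_) (∩-absorb s)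

  ∩-─ : ∀ {k} {X V : Subset k} (S : Subset k) → X ⊑ V → X ∩ (V ─ S) ≡ X ─ S
  ∩-─ []          []       = refl
  ∩-─ (true ∷ S)  (skip s) = cong (false ∷_) (∩-─ S s)
  ∩-─ (false ∷ S) (skip s) = cong (false ∷_) (∩-─ S s)
  ∩-─ (true ∷ S)  (take s) = cong (false ∷_) (∩-─ S s)
  ∩-─ (false ∷ S) (take s) = cong (true ∷_) (∩-─ S s)

  ─-─ : ∀ {k} (V X : Subset k) → V ─ (V ─ X) ≡ V ∩ X
  ─-─ []          []      = refl
  ─-─ (true ∷ V)  (true ∷ X)  = cong (true ∷_) (─-─ V X)
  ─-─ (true ∷ V)  (false ∷ X) = cong (false ∷_) (─-─ V X)
  ─-─ (false ∷ V) (true ∷ X)  = cong (false ∷_) (─-─ V X)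
  ─-─ (false ∷ V) (false ∷ X) = cong (false ∷_) (─-─ V X)

  ─-─-absorb : ∀ {k} {X V : Subset k} → X ⊑ V → V ─ (V ─ X) ≡ X
  ─-─-absorb {X = X} {V} X⊑V = trans (─-─ V X) (trans (∩-comm V X) (∩-absorb X⊑V))

module Points where

  open import Data.Bool using (true; false)
  open import Data.Maybe using (just; nothing)
  open import Data.Vec using ([]; _∷_; replicate)
  open import Data.Fin.Subset using (Subset; _∩_; _─_)
  open import Relation.Binary.PropositionalEquality
  open import Data.Fin using (_≟_)
  open import Relation.Nullary using (yes)
  open import Relation.Nullary.Decidable using (dec-true; isYes≗does)
  open import Defs using (Pt; restrict; ext; eqPt)
  open Booleans
  open Subsets

  data IsPt {n : ℕ} : {k : ℕ} → Subset k → Pt n k → Set where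
    []      : IsPt [] []
    defined : ∀ {k a} {V : Subset k} {x} → IsPt V x → IsPt (true ∷ V) (just a ∷ x)
    blank∷  : ∀ {k} {V : Subset k} {x} → IsPt V x → IsPt (false ∷ V) (nothing ∷ x)

  blank : ∀ {n k} → Pt n k
  blank = replicate _ nothing

  module _ {n : ℕ} where

    ispt-ext : ∀ {k} {V X Y : Subset k} {y z : Pt n k} →
      Split V X Y → IsPt X y → IsPt Y z → IsPt V (ext y z)
    ispt-ext []        []          []          = []
    ispt-ext (left s)  (defined y) (blank∷ z)  = defined (ispt-ext s y z)
    ispt-ext (right s) (blank∷ y)  (defined z) = defined (ispt-ext s y z)
    ispt-ext (none s)  (blank∷ y)  (blank∷ z)  = blank∷ (ispt-ext s y z)

    ispt-restrict : ∀ {k} (X : Subset k) {Y : Subset k} {x : Pt n k} →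
      IsPt Y x → IsPt (X ∩ Y) (restrict X x)
    ispt-restrict []          []          = []
    ispt-restrict (true ∷ X)  (defined x) = defined (ispt-restrict X x)
    ispt-restrict (true ∷ X)  (blank∷ x)  = blank∷ (ispt-restrict X x)
    ispt-restrict (false ∷ X) (defined x) = blank∷ (ispt-restrict X x)
    ispt-restrict (false ∷ X) (blank∷ x)  = blank∷ (ispt-restrict X x)

    restrict-id : ∀ {k} {Y X : Subset k} {y : Pt n k} → Y ⊑ X → IsPt Y y → restrict X y ≡ y
    restrict-id []                  []          = refl
    restrict-id (skip {b = true} s)  (blank∷ y)  = cong (nothing ∷_) (restrict-id s y)
    restrict-id (skip {b = false} s) (blank∷ y)  = cong (nothing ∷_) (restrict-id s y)
    restrict-id (take s)             (defined y) = cong (_ ∷_) (restrict-id s y)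

    restrict-outside : ∀ {k} (Y X : Subset k) {z : Pt n k} → IsPt (Y ─ X) z → restrict X z ≡ blank
    restrict-outside []          []          []          = refl
    restrict-outside (true ∷ Y)  (true ∷ X)  (blank∷ z)  = cong (nothing ∷_) (restrict-outside Y X z)
    restrict-outside (false ∷ Y) (true ∷ X)  (blank∷ z)  = cong (nothing ∷_) (restrict-outside Y X z)
    restrict-outside (true ∷ Y)  (false ∷ X) (defined z) = cong (nothing ∷_) (restrict-outside Y X z)
    restrict-outside (false ∷ Y) (false ∷ X) (blank∷ z)  = cong (nothing ∷_) (restrict-outside Y X z)

    restrict-restrict : ∀ {k} {X Y : Subset k} → X ⊑ Y → (x : Pt n k) →
      restrict X (restrict Y x) ≡ restrict X x
    restrict-restrict []                  []      = refl
    restrict-restrict (skip {b = true} s)  (a ∷ x) = cong (nothing ∷_) (restrict-restrict s x)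
    restrict-restrict (skip {b = false} s) (a ∷ x) = cong (nothing ∷_) (restrict-restrict s x)
    restrict-restrict (take s)             (a ∷ x) = cong (a ∷_) (restrict-restrict s x)

    restrict-ext : ∀ {k} (X : Subset k) (y z : Pt n k) →
      restrict X (ext y z) ≡ ext (restrict X y) (restrict X z)
    restrict-ext []          []             []      = refl
    restrict-ext (true ∷ X)  (just a ∷ y)  (b ∷ z) = cong (just a ∷_) (restrict-ext X y z)
    restrict-ext (true ∷ X)  (nothing ∷ y) (b ∷ z) = cong (b ∷_) (restrict-ext X y z)
    restrict-ext (false ∷ X) (just a ∷ y)  (b ∷ z) = cong (nothing ∷_) (restrict-ext X y z)
    restrict-ext (false ∷ X) (nothing ∷ y) (b ∷ z) = cong (nothing ∷_) (restrict-ext X y z)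

    ext-blankˡ : ∀ {k} (z : Pt n k) → ext blank z ≡ z
    ext-blankˡ []      = refl
    ext-blankˡ (b ∷ z) = cong (b ∷_) (ext-blankˡ z)

    ext-blankʳ : ∀ {k} (y : Pt n k) → ext y blank ≡ y
    ext-blankʳ []            = refl
    ext-blankʳ (just a ∷ y)  = cong (just a ∷_) (ext-blankʳ y)
    ext-blankʳ (nothing ∷ y) = cong (nothing ∷_) (ext-blankʳ y)

    ext-assoc : ∀ {k} (y w z : Pt n k) → ext (ext y w) z ≡ ext y (ext w z)
    ext-assoc []            []            []      = refl
    ext-assoc (just a ∷ y)  (just b ∷ w)  (c ∷ z) = cong (just a ∷_) (ext-assoc y w z)
    ext-assoc (just a ∷ y)  (nothing ∷ w) (c ∷ z) = cong (just a ∷_) (ext-assoc y w z)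
    ext-assoc (nothing ∷ y) (just b ∷ w)  (c ∷ z) = cong (just b ∷_) (ext-assoc y w z)
    ext-assoc (nothing ∷ y) (nothing ∷ w) (c ∷ z) = cong (c ∷_) (ext-assoc y w z)

    restrict-ext-drop : ∀ {k} (Y X : Subset k) {y : Pt n k} (z : Pt n k) →
      IsPt (Y ─ X) y → restrict X (ext y z) ≡ restrict X z
    restrict-ext-drop Y X {y} z y∈Y─X = begin
      restrict X (ext y z)                ≡⟨ restrict-ext X y z ⟩
      ext (restrict X y) (restrict X z)   ≡⟨ cong (λ w → ext w (restrict X z)) (restrict-outside Y X y∈Y─X) ⟩
      ext blank (restrict X z)            ≡⟨ ext-blankˡ (restrict X z) ⟩
      restrict X z                        ∎
      where open ≡-Reasoning

    restrict-ext-keep : ∀ {k} {Y X : Subset k} {y : Pt n k} (z : Pt n k) →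
      Y ⊑ X → IsPt Y y → restrict X (ext y z) ≡ ext y (restrict X z)
    restrict-ext-keep {X = X} {y} z Y⊑X y∈Y =
      trans (restrict-ext X y z) (cong (λ w → ext w (restrict X z)) (restrict-id Y⊑X y∈Y))

    eqPt-refl : ∀ {k} (x : Pt n k) → eqPt x x ≡ true
    eqPt-refl []             = refl
    eqPt-refl (nothing ∷ x)  = eqPt-refl x
    eqPt-refl (just a ∷ x)   = ∧-intro (trans (isYes≗does (a ≟ a)) (dec-true (a ≟ a) refl)) (eqPt-refl x)

    eqPt-sound : ∀ {k} (x y : Pt n k) → eqPt x y ≡ true → x ≡ y
    eqPt-sound []            []            _  = refl
    eqPt-sound (nothing ∷ x) (nothing ∷ y) eq = cong (nothing ∷_) (eqPt-sound x y eq)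
    eqPt-sound (just a ∷ x)  (just b ∷ y)  eq with a ≟ b
    ... | yes refl = cong (just a ∷_) (eqPt-sound x y eq)

module Counting (n : ℕ) where

  open import Data.Nat using (suc; _+_; _*_; _^_; _≤_; z≤n; s≤s)
  open import Data.Nat.Properties
    using (≤-trans; ≤-reflexive; +-mono-≤; *-identityʳ; +-identityʳ; module ≤-Reasoning)
  open import Data.Bool using (Bool; true; false; _∧_)
  open import Data.Maybe using (just; nothing)
  open import Data.List using (map; allFin; length)
  open import Data.List.Properties using (length-tabulate)
  open import Data.List.Membership.Propositional using (_∈_)
  open import Data.List.Membership.Propositional.Properties
    using (∈-map⁺; ∈-map⁻; ∈-concat⁺′; ∈-concat⁻′; ∈-allFin)
  open import Data.List.Relation.Unary.Any using (here)
  open import Data.Vec using ([]; _∷_)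
  open import Data.Fin.Subset using (Subset; _─_; ∣_∣)
  open import Data.Product using (Σ-syntax; _×_; _,_)
  open import Relation.Binary.PropositionalEquality
  open import Defs
  open Sums
  open Booleans
  open Subsets
  open Points

  Σ-points-in : ∀ {k} (V : Subset k) (f : Pt n (suc k) → ℕ) →
    Σ (points n (true ∷ V)) f ≡ Σ (allFin n) (λ a → Σ (points n V) (λ x → f (just a ∷ x)))
  Σ-points-in V f = trans (Σ-concatMap (λ a → map (just a ∷_) (points n V)) (allFin n) f)
                          (Σ-cong (allFin n) (λ a → Σ-map (just a ∷_) (points n V) f))

  Σ-points-out : ∀ {k} (V : Subset k) (f : Pt n (suc k) → ℕ) →
    Σ (points n (false ∷ V)) f ≡ Σ (points n V) (λ x → f (nothing ∷ x))
  Σ-points-out V f = Σ-map (nothing ∷_) (points n V) f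

  Σ-points-split : ∀ {k} {V X Y : Subset k} → Split V X Y → (f : Pt n k → ℕ) →
    Σ (points n V) f ≡ Σ (points n Y) (λ z → Σ (points n X) (λ y → f (ext y z)))
  Σ-points-split [] f = cong (_+ 0) (sym (+-identityʳ (f [])))
  Σ-points-split {V = true ∷ V} {true ∷ X} {false ∷ Y} (left s) f = begin
      Σ (points n (true ∷ V)) f
    ≡⟨ Σ-points-in V f ⟩
      Σ (allFin n) (λ a → Σ (points n V) (λ x → f (just a ∷ x)))
    ≡⟨ Σ-cong (allFin n) (λ a → Σ-points-split s (λ x → f (just a ∷ x))) ⟩
      Σ (allFin n) (λ a → Σ (points n Y) (λ z → Σ (points n X) (λ y → f (just a ∷ ext y z))))
    ≡⟨ Σ-swap (allFin n) (points n Y) _ ⟩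
      Σ (points n Y) (λ z → Σ (allFin n) (λ a → Σ (points n X) (λ y → f (just a ∷ ext y z))))
    ≡⟨ Σ-cong (points n Y) (λ z → sym (Σ-points-in X (λ y → f (ext y (nothing ∷ z))))) ⟩
      Σ (points n Y) (λ z → Σ (points n (true ∷ X)) (λ y → f (ext y (nothing ∷ z))))
    ≡⟨ sym (Σ-points-out Y _) ⟩
      Σ (points n (false ∷ Y)) (λ z → Σ (points n (true ∷ X)) (λ y → f (ext y z)))
    ∎ where open ≡-Reasoning
  Σ-points-split {V = true ∷ V} {false ∷ X} {true ∷ Y} (right s) f = begin
      Σ (points n (true ∷ V)) f
    ≡⟨ Σ-points-in V f ⟩
      Σ (allFin n) (λ a → Σ (points n V) (λ x → f (just a ∷ x)))
    ≡⟨ Σ-cong (allFin n) (λ a → Σ-points-split s (λ x → f (just a ∷ x))) ⟩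
      Σ (allFin n) (λ a → Σ (points n Y) (λ z → Σ (points n X) (λ y → f (just a ∷ ext y z))))
    ≡⟨ Σ-cong (allFin n) (λ a → Σ-cong (points n Y) (λ z →
         sym (Σ-points-out X (λ y → f (ext y (just a ∷ z)))))) ⟩
      Σ (allFin n) (λ a → Σ (points n Y) (λ z → Σ (points n (false ∷ X)) (λ y → f (ext y (just a ∷ z)))))
    ≡⟨ sym (Σ-points-in Y _) ⟩
      Σ (points n (true ∷ Y)) (λ z → Σ (points n (false ∷ X)) (λ y → f (ext y z)))
    ∎ where open ≡-Reasoning
  Σ-points-split {V = false ∷ V} {false ∷ X} {false ∷ Y} (none s) f = begin
      Σ (points n (false ∷ V)) f
    ≡⟨ Σ-points-out V f ⟩
      Σ (points n V) (λ x → f (nothing ∷ x))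
    ≡⟨ Σ-points-split s (λ x → f (nothing ∷ x)) ⟩
      Σ (points n Y) (λ z → Σ (points n X) (λ y → f (nothing ∷ ext y z)))
    ≡⟨ Σ-cong (points n Y) (λ z → sym (Σ-points-out X (λ y → f (ext y (nothing ∷ z))))) ⟩
      Σ (points n Y) (λ z → Σ (points n (false ∷ X)) (λ y → f (ext y (nothing ∷ z))))
    ≡⟨ sym (Σ-points-out Y _) ⟩
      Σ (points n (false ∷ Y)) (λ z → Σ (points n (false ∷ X)) (λ y → f (ext y z)))
    ∎ where open ≡-Reasoning

  Σ-points-mono : ∀ {k} (V : Subset k) {f g : Pt n k → ℕ} →
    (∀ x → IsPt V x → f x ≤ g x) → Σ (points n V) f ≤ Σ (points n V) g
  Σ-points-mono []          f≤g = +-mono-≤ (f≤g [] []) z≤n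
  Σ-points-mono (true ∷ V)  {f} {g} f≤g = subst₂ _≤_ (sym (Σ-points-in V f)) (sym (Σ-points-in V g))
    (Σ-mono (allFin n) (λ a → Σ-points-mono V (λ x x∈V → f≤g _ (defined x∈V))))
  Σ-points-mono (false ∷ V) {f} {g} f≤g = subst₂ _≤_ (sym (Σ-points-out V f)) (sym (Σ-points-out V g))
    (Σ-points-mono V (λ x x∈V → f≤g _ (blank∷ x∈V)))

  points-complete : ∀ {k} {V : Subset k} {x} → IsPt V x → x ∈ points n V
  points-complete []                 = here refl
  points-complete {V = true ∷ V} (defined {a = a} x∈V) =
    ∈-concat⁺′ (∈-map⁺ (just a ∷_) (points-complete x∈V))
               (∈-map⁺ (λ a → map (just a ∷_) (points n V)) (∈-allFin a))
  points-complete (blank∷ x∈V)       = ∈-map⁺ (nothing ∷_) (points-complete x∈V)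

  points-sound : ∀ {k} (V : Subset k) {x} → x ∈ points n V → IsPt V x
  points-sound []          (here refl) = []
  points-sound (true ∷ V)  x∈ with ∈-concat⁻′ (map (λ a → map (just a ∷_) (points n V)) (allFin n)) x∈
  ... | xs , x∈xs , xs∈ with ∈-map⁻ (λ a → map (just a ∷_) (points n V)) xs∈
  ... | a , _ , refl with ∈-map⁻ (just a ∷_) x∈xs
  ... | y , y∈ , refl = defined (points-sound V y∈)
  points-sound (false ∷ V) x∈ with ∈-map⁻ (nothing ∷_) x∈
  ... | y , y∈ , refl = blank∷ (points-sound V y∈)

  count : ∀ {k} → Subset k → (Pt n k → Bool) → ℕ
  count X p = countB p (points n X)

  count-as-Σ : ∀ {k} (X : Subset k) (p : Pt n k → Bool) → count X p ≡ Σ (points n X) (λ x → ⟦ p x ⟧)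
  count-as-Σ X p = countB-as-Σ p (points n X)

  count-split : ∀ {k} {V X Y : Subset k} → Split V X Y → (p : Pt n k → Bool) →
    count V p ≡ Σ (points n Y) (λ z → count X (λ y → p (ext y z)))
  count-split {V = V} {X} {Y} s p = begin
    count V p                                                     ≡⟨ count-as-Σ V p ⟩
    Σ (points n V) (λ x → ⟦ p x ⟧)                                ≡⟨ Σ-points-split s (λ x → ⟦ p x ⟧) ⟩
    Σ (points n Y) (λ z → Σ (points n X) (λ y → ⟦ p (ext y z) ⟧)) ≡⟨ Σ-cong (points n Y) (λ z → sym (count-as-Σ X _)) ⟩
    Σ (points n Y) (λ z → count X (λ y → p (ext y z)))            ∎
    where open ≡-Reasoning

  ⟦⟧-mono : ∀ {a b} → (a ≡ true → b ≡ true) → ⟦ a ⟧ ≤ ⟦ b ⟧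
  ⟦⟧-mono {false} a⇒b = z≤n
  ⟦⟧-mono {true}  a⇒b rewrite a⇒b refl = s≤s z≤n

  count-mono : ∀ {k} (X : Subset k) {p q : Pt n k → Bool} →
    (∀ x → IsPt X x → p x ≡ true → q x ≡ true) → count X p ≤ count X q
  count-mono X {p} {q} p⇒q = subst₂ _≤_ (sym (count-as-Σ X p)) (sym (count-as-Σ X q))
    (Σ-points-mono X (λ x x∈X → ⟦⟧-mono (p⇒q x x∈X)))

  count-none : ∀ {k} (X : Subset k) → count X (λ _ → false) ≡ 0
  count-none X = trans (count-as-Σ X _) (Σ-zero (points n X))

  count-all : ∀ {k} (X : Subset k) → count X (λ _ → true) ≡ n ^ ∣ X ∣
  count-all X = trans (count-as-Σ X _) (size X)
    where
    size : ∀ {k} (X : Subset k) → Σ (points n X) (λ _ → 1) ≡ n ^ ∣ X ∣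
    size []          = refl
    size (true ∷ X)  = begin
      Σ (points n (true ∷ X)) (λ _ → 1)                  ≡⟨ Σ-points-in X _ ⟩
      Σ (allFin n) (λ _ → Σ (points n X) (λ _ → 1))      ≡⟨ Σ-cong (allFin n) (λ _ → size X) ⟩
      Σ (allFin n) (λ _ → n ^ ∣ X ∣)                     ≡⟨ Σ-const (allFin n) _ ⟩
      length (allFin n) * n ^ ∣ X ∣                     ≡⟨ cong (_* n ^ ∣ X ∣) (length-tabulate {n = n} (λ i → i)) ⟩
      n * n ^ ∣ X ∣                                       ∎
      where open ≡-Reasoning
    size (false ∷ X) = trans (Σ-points-out X _) (size X)

  count-by-fibres : ∀ {k} {V X Y : Subset k} → Split V X Y →
    (p q : Pt n k → Bool) (m : ℕ) →
    (∀ z → IsPt Y z → count X (λ y → p (ext y z)) ≤ m) →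
    (∀ y z → IsPt X y → IsPt Y z → p (ext y z) ≡ true → q z ≡ true) →
    count V p ≤ m * count Y q
  count-by-fibres {V = V} {X} {Y} s p q m small support = begin
    count V p                                            ≡⟨ count-split s p ⟩
    Σ (points n Y) (λ z → count X (λ y → p (ext y z)))   ≤⟨ Σ-points-mono Y fibre ⟩
    Σ (points n Y) (λ z → m * ⟦ q z ⟧)                   ≡⟨ Σ-*ˡ (points n Y) m (λ z → ⟦ q z ⟧) ⟩
    m * Σ (points n Y) (λ z → ⟦ q z ⟧)                   ≡⟨ cong (m *_) (sym (count-as-Σ Y q)) ⟩
    m * count Y q                                        ∎
    where
    open ≤-Reasoning
    fibre : ∀ z → IsPt Y z → count X (λ y → p (ext y z)) ≤ m * ⟦ q z ⟧
    fibre z z∈Y with q z in qz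
    ... | true  = ≤-trans (small z z∈Y) (≤-reflexive (sym (*-identityʳ m)))
    ... | false = ≤-trans (count-mono X {q = λ _ → false} (λ y y∈X pyz → trans (sym qz) (support y z y∈X z∈Y pyz)))
                          (≤-trans (≤-reflexive (count-none X)) z≤n)

  count-by-uniform-fibres : ∀ {k} {V X Y : Subset k} → Split V X Y →
    (p : Pt n k → Bool) (m : ℕ) →
    (∀ z → IsPt Y z → count X (λ y → p (ext y z)) ≤ m) →
    count V p ≤ m * n ^ ∣ Y ∣
  count-by-uniform-fibres {V = V} {Y = Y} s p m small =
    subst (λ c → count V p ≤ m * c) (count-all Y)
      (count-by-fibres s p (λ _ → true) m small (λ _ _ _ _ _ → refl))

  proj-intro : ∀ {k} (X : Subset k) (A : Rel n k) {x t : Pt n k} →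
    IsPt (dom A) x → mem A x ≡ true → restrict X x ≡ t → mem (proj X A) t ≡ true
  proj-intro X A {x} x∈V x∈A refl =
    any-intro (λ x′ → mem A x′ ∧ eqPt (restrict X x′) (restrict X x)) (points-complete x∈V)
              (∧-intro x∈A (eqPt-refl (restrict X x)))

  proj-elim : ∀ {k} (X : Subset k) (A : Rel n k) {t : Pt n k} → mem (proj X A) t ≡ true →
    Σ[ x ∈ Pt n k ] (IsPt (dom A) x × mem A x ≡ true × restrict X x ≡ t)
  proj-elim X A {t} t∈proj with any-elim (λ x → mem A x ∧ eqPt (restrict X x) t) (points n (dom A)) t∈proj
  ... | x , x∈pts , hx = x , points-sound (dom A) x∈pts , ∧-elimˡ hx , eqPt-sound _ _ (∧-elimʳ (mem A x) hx)

  proj-restrict : ∀ {k} (A : Rel n k) {X Y : Subset k} → X ⊑ Y → {y w : Pt n k} →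
    IsPt X y → IsPt (Y ─ X) w → mem (proj Y A) (ext y w) ≡ true → mem (proj X A) y ≡ true
  proj-restrict A {X} {Y} X⊑Y {y} {w} y∈X w∈Y─X yw∈proj with proj-elim Y A yw∈proj
  ... | x , x∈V , x∈A , x_Y≡yw = proj-intro X A x∈V x∈A (begin
    restrict X x                  ≡⟨ sym (restrict-restrict X⊑Y x) ⟩
    restrict X (restrict Y x)     ≡⟨ cong (restrict X) x_Y≡yw ⟩
    restrict X (ext y w)          ≡⟨ restrict-ext-keep w ⊑-refl y∈X ⟩
    ext y (restrict X w)          ≡⟨ cong (ext y) (restrict-outside Y X w∈Y─X) ⟩
    ext y blank                   ≡⟨ ext-blankʳ y ⟩
    y                             ∎)
    where open ≡-Reasoning

  -- If x ∈ [n]^D has x_U ∈ C for the domain U ⊆ D of C, then x_X ∈ proj_X(C)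
  -- for every X ⊆ U; this is how a point of a join projects to its factors.
  proj-of-restrict : ∀ {k} (C : Rel n k) {X D : Subset k} {x : Pt n k} →
    X ⊑ dom C → dom C ⊑ D → IsPt D x → mem C (restrict (dom C) x) ≡ true →
    mem (proj X C) (restrict X x) ≡ true
  proj-of-restrict C X⊑U U⊑D x∈D x_U∈C =
    proj-intro _ C (subst (λ Z → IsPt Z _) (∩-absorb U⊑D) (ispt-restrict (dom C) x∈D)) x_U∈C
               (restrict-restrict X⊑U _)

  -- maxFiber X R A = max_{z ∈ [n]^R} |A|^z_X|, the numerator of μ.
  maxFiber : ∀ {k} → Subset k → Subset k → Rel n k → ℕ
  maxFiber X R A = maxList (map (λ z → card (fiber X A z)) (points n R))

  fiber-≤-max : ∀ {k} (X R : Subset k) (A : Rel n k) {z : Pt n k} →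
    IsPt R z → card (fiber X A z) ≤ maxFiber X R A
  fiber-≤-max X R A z∈R = maxList-≥ (λ z → card (fiber X A z)) (points-complete z∈R)

  maxFiber-≤ : ∀ {k} (X R : Subset k) (A : Rel n k) {b : ℕ} →
    (∀ z → IsPt R z → card (fiber X A z) ≤ b) → maxFiber X R A ≤ b
  maxFiber-≤ X R A small =
    maxList-≤ (λ z → card (fiber X A z)) (points n R) (λ z z∈pts → small z (points-sound R z∈pts))

module Bounds {k : ℕ} (n : ℕ) where

  open import Data.Nat using (_*_; _^_; _≤_)
  open import Data.Nat.Properties using (≤-trans; *-monoʳ-≤; *-comm; module ≤-Reasoning)
  open import Data.Bool using (Bool; true; _∧_)
  open import Data.Fin.Subset using (Subset; _∪_; _─_; ∣_∣)
  open import Data.Fin.Subset.Properties using (p⊆p∪q; q⊆p∪q; p─q⊆p; p─q─r≡p─q∪r; ∪-comm)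
  open import Relation.Binary.PropositionalEquality
  open import Defs
  open Booleans
  open Subsets
  open Points
  open Counting n

  -- (a1) An S⁺-fibre is a union of n^|S⁺∖S| many S-fibres.
  maxFiber-shrink : (A : Rel n k) {S S⁺ : Subset k} → S ⊑ S⁺ → S⁺ ⊑ dom A →
    maxFiber S⁺ (dom A ─ S⁺) A ≤ maxFiber S (dom A ─ S) A * n ^ ∣ S⁺ ─ S ∣
  maxFiber-shrink A {S} {S⁺} S⊑S⁺ S⁺⊑V = maxFiber-≤ S⁺ _ A λ z z∈ →
    count-by-uniform-fibres (split-─ S⊑S⁺) (λ y → mem A (ext y z)) _ λ w w∈ →
      ≤-trans (count-mono S (λ y _ h → trans (cong (mem A) (sym (ext-assoc y w z))) h))
              (fiber-≤-max S (dom A ─ S) A (ispt-ext (split-nested S⊑S⁺ S⁺⊑V) w∈ z∈))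

  -- (a2) The S-fibre of A at z lies in the S-fibre of proj_{S⁺}(A) at z_{S⁺}.
  maxFiber-≤-proj : (A : Rel n k) {S S⁺ : Subset k} → S ⊑ S⁺ → S⁺ ⊑ dom A →
    maxFiber S (dom A ─ S) A ≤ maxFiber S (S⁺ ─ S) (proj S⁺ A)
  maxFiber-≤-proj A {S} {S⁺} S⊑S⁺ S⁺⊑V = maxFiber-≤ S _ A λ z z∈ →
    ≤-trans (count-mono S (λ y y∈ yz∈A →
               proj-intro S⁺ A (ispt-ext (split-─ (⊑-trans S⊑S⁺ S⁺⊑V)) y∈ z∈) yz∈A
                          (restrict-ext-keep z S⊑S⁺ y∈)))
            (fiber-≤-max S (S⁺ ─ S) (proj S⁺ A)
               (subst (λ Z → IsPt Z (restrict S⁺ z)) (∩-─ S S⁺⊑V) (ispt-restrict S⁺ z∈)))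

  -- (a3) Every S-fibre of proj_{S⁺}(A) lies in proj_S(A).
  maxFiber-proj-≤ : (A : Rel n k) {S S⁺ : Subset k} → S ⊑ S⁺ →
    maxFiber S (S⁺ ─ S) (proj S⁺ A) ≤ card (proj S A)
  maxFiber-proj-≤ A {S} {S⁺} S⊑S⁺ = maxFiber-≤ S _ (proj S⁺ A) λ w w∈ →
    count-mono S (λ y y∈ yw∈ → proj-restrict A S⊑S⁺ y∈ w∈ yw∈)

  -- (a4) Every fibre of proj_S(A) over S∖S⁻ lies in proj_{S⁻}(A).
  proj-shrink : (A : Rel n k) {S⁻ S : Subset k} → S⁻ ⊑ S →
    card (proj S A) ≤ card (proj S⁻ A) * n ^ ∣ S ─ S⁻ ∣
  proj-shrink A {S⁻} {S} S⁻⊑S = count-by-uniform-fibres (split-─ S⁻⊑S) (mem (proj S A)) _ λ w w∈ →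
    count-mono S⁻ (λ y y∈ yw∈ → proj-restrict A S⁻⊑S y∈ w∈ yw∈)

  -- (b) Fibres over z ∈ [n]^S have at most max-fibre size and are empty unless z ∈ proj_S(A).
  card-≤-proj*fiber : (A : Rel n k) {S : Subset k} → S ⊑ dom A →
    card A ≤ card (proj S A) * maxFiber (dom A ─ S) S A
  card-≤-proj*fiber A {S} S⊑V = subst (card A ≤_) (*-comm _ (card (proj S A)))
    (count-by-fibres (split-swap (split-─ S⊑V)) (mem A) (mem (proj S A)) _
      (λ z z∈ → fiber-≤-max (dom A ─ S) S A z∈)
      (λ y z y∈ z∈ yz∈A → proj-intro S A (ispt-ext (split-swap (split-─ S⊑V)) y∈ z∈) yz∈A
         (trans (restrict-ext-drop (dom A) S z y∈) (restrict-id ⊑-refl z∈))))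

  -- A point z of [n]^(S∪T) is compatible with A and B when z_S ∈ proj_S(A)
  -- and z_T ∈ proj_T(B); only over such z can A ⋈ B have a nonempty fibre.
  compatible : Rel n k → Rel n k → Subset k → Subset k → Pt n k → Bool
  compatible A B S T z = mem (proj S A) (restrict S z) ∧ mem (proj T B) (restrict T z)

  -- (c), first step: with D = V ∪ W, the fibres of A ⋈ B over z ∈ [n]^(S∪T)
  -- have at most M₃ elements and are empty unless z is compatible.
  card-join-≤ : (A B : Rel n k) {S T : Subset k} → S ⊑ dom A → T ⊑ dom B →
    card (join A B) ≤ maxFiber ((dom A ∪ dom B) ─ (S ∪ T)) (S ∪ T) (join A B)
                        * count (S ∪ T) (compatible A B S T)
  card-join-≤ A B {S} {T} S⊑V T⊑W =
    count-by-fibres D-split (mem (join A B)) (compatible A B S T) _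
      (λ z z∈ → fiber-≤-max U (S ∪ T) (join A B) z∈) support
    where
    V W D U : Subset k
    V = dom A
    W = dom B
    D = V ∪ W
    U = D ─ (S ∪ T)

    V⊑D : V ⊑ D
    V⊑D = ⊆⇒⊑ (p⊆p∪q W)

    W⊑D : W ⊑ D
    W⊑D = ⊆⇒⊑ (q⊆p∪q V W)

    D-split : Split D U (S ∪ T)
    D-split = split-swap (split-─ (∪-mono S⊑V T⊑W))

    U≡D─T─S : U ≡ D ─ T ─ S
    U≡D─T─S = sym (trans (p─q─r≡p─q∪r D T S) (cong (D ─_) (∪-comm T S)))

    U≡D─S─T : U ≡ D ─ S ─ T
    U≡D─S─T = sym (p─q─r≡p─q∪r D S T)

    support : ∀ y z → IsPt U y → IsPt (S ∪ T) z → mem (join A B) (ext y z) ≡ true →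
      compatible A B S T z ≡ true
    support y z y∈U z∈ yz∈J = ∧-intro
      (subst (λ t → mem (proj S A) t ≡ true)
        (restrict-ext-drop (D ─ T) S z (subst (λ Z → IsPt Z y) U≡D─T─S y∈U))
        (proj-of-restrict A S⊑V V⊑D yz∈D (∧-elimˡ yz∈J)))
      (subst (λ t → mem (proj T B) t ≡ true)
        (restrict-ext-drop (D ─ S) T z (subst (λ Z → IsPt Z y) U≡D─S─T y∈U))
        (proj-of-restrict B T⊑W W⊑D yz∈D (∧-elimʳ (mem A (restrict V (ext y z))) yz∈J)))
      where
      yz∈D : IsPt D (ext y z)
      yz∈D = ispt-ext D-split y∈U z∈

  -- (c), second step: grouped by s = z_S ∈ proj_S(A), the compatible z = ws
  -- (w ∈ [n]^(T∖S)) have ws_T in the fibre of proj_T(B) at s_T.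
  count-compatible : (A B : Rel n k) (S T : Subset k) →
    count (S ∪ T) (compatible A B S T) ≤ maxFiber (T ─ S) (T ─ (T ─ S)) (proj T B) * card (proj S A)
  count-compatible A B S T =
    count-by-fibres (split-∪ S T) (compatible A B S T) (mem (proj S A)) _ small support
    where
    small : ∀ s → IsPt S s → count (T ─ S) (λ w → compatible A B S T (ext w s))
                               ≤ maxFiber (T ─ S) (T ─ (T ─ S)) (proj T B)
    small s s∈ = ≤-trans
      (count-mono (T ─ S) (λ w w∈ ws∈ → subst (λ t → mem (proj T B) t ≡ true)
         (restrict-ext-keep s (⊆⇒⊑ (p─q⊆p T S)) w∈) (∧-elimʳ (mem (proj S A) (restrict S (ext w s))) ws∈)))
      (fiber-≤-max (T ─ S) (T ─ (T ─ S)) (proj T B)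
         (subst (λ Z → IsPt Z (restrict T s)) (sym (─-─ T S)) (ispt-restrict T s∈)))

    support : ∀ w s → IsPt (T ─ S) w → IsPt S s → compatible A B S T (ext w s) ≡ true →
      mem (proj S A) s ≡ true
    support w s w∈ s∈ ws∈ = subst (λ t → mem (proj S A) t ≡ true)
      (trans (restrict-ext-drop T S s w∈) (restrict-id ⊑-refl s∈)) (∧-elimˡ ws∈)

  card-join : (A B : Rel n k) {S T : Subset k} → S ⊑ dom A → T ⊑ dom B →
    card (join A B) ≤ (card (proj S A) * maxFiber (T ─ S) (T ─ (T ─ S)) (proj T B))
                        * maxFiber ((dom A ∪ dom B) ─ (S ∪ T)) (S ∪ T) (join A B)
  card-join A B {S} {T} S⊑V T⊑W = begin
    card (join A B)                            ≤⟨ card-join-≤ A B S⊑V T⊑W ⟩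
    M₃ * count (S ∪ T) (compatible A B S T)    ≤⟨ *-monoʳ-≤ M₃ (count-compatible A B S T) ⟩
    M₃ * (M₂ * card (proj S A))                ≡⟨ *-comm M₃ _ ⟩
    M₂ * card (proj S A) * M₃                  ≡⟨ cong (_* M₃) (*-comm M₂ _) ⟩
    card (proj S A) * M₂ * M₃                  ∎
    where
    open ≤-Reasoning
    M₂ M₃ : ℕ
    M₂ = maxFiber (T ─ S) (T ─ (T ─ S)) (proj T B)
    M₃ = maxFiber ((dom A ∪ dom B) ─ (S ∪ T)) (S ∪ T) (join A B)

module Densities {k : ℕ} (n : ℕ) .{{_ : NonZero n}} where

  import Data.Nat as ℕ
  open import Data.Nat using (_^_)
  open import Data.Nat.Properties using (m^n≢0; m*n≢0; ^-distribˡ-+-*; *-monoˡ-≤; *-assoc; *-comm; module ≤-Reasoning)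
  open import Data.Rational using (ℚ; _≤_; _*_)
  open import Data.Fin.Subset using (Subset; _∩_; _∪_; _─_; ∣_∣)
  open import Data.Fin.Subset.Properties using (p─q⊆p)
  open import Relation.Binary.PropositionalEquality
  open import Defs
  open Fractions
  open Subsets
  open Counting n using (maxFiber)
  open Bounds {k} n

  ratio : ℕ → Subset k → ℚ
  ratio a X = frac a (n ^ ∣ X ∣) {{m^n≢0 n ∣ X ∣}}

  pow-split : {V X Y : Subset k} → Split V X Y → n ^ ∣ V ∣ ≡ n ^ ∣ X ∣ ℕ.* n ^ ∣ Y ∣
  pow-split {X = X} {Y} s = trans (cong (n ^_) (split-size s)) (^-distribˡ-+-* n ∣ X ∣ ∣ Y ∣)

  ratio-mono : ∀ a c (X : Subset k) → a ℕ.≤ c → ratio a X ≤ ratio c X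
  ratio-mono a c X a≤c =
    frac-≤ a (n ^ ∣ X ∣) c (n ^ ∣ X ∣) {{m^n≢0 n ∣ X ∣}} {{m^n≢0 n ∣ X ∣}} (*-monoˡ-≤ (n ^ ∣ X ∣) a≤c)

  ratio-* : ∀ a c {V X Y : Subset k} → Split V X Y → ratio a X * ratio c Y ≡ ratio (a ℕ.* c) V
  ratio-* a c {V} {X} {Y} s =
    trans (frac-* a (n ^ ∣ X ∣) c (n ^ ∣ Y ∣) {{m^n≢0 n ∣ X ∣}} {{m^n≢0 n ∣ Y ∣}})
          (frac-cong (a ℕ.* c) {{m*n≢0 (n ^ ∣ X ∣) (n ^ ∣ Y ∣) {{m^n≢0 n ∣ X ∣}} {{m^n≢0 n ∣ Y ∣}}}}
                     {{m^n≢0 n ∣ V ∣}} (sym (pow-split s)))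

  ratio-≤-scaled : ∀ a c {X Y Z : Subset k} → Split X Y Z → a ℕ.≤ c ℕ.* n ^ ∣ Z ∣ → ratio a X ≤ ratio c Y
  ratio-≤-scaled a c {X} {Y} {Z} s a≤cnᶻ =
    frac-≤ a (n ^ ∣ X ∣) c (n ^ ∣ Y ∣) {{m^n≢0 n ∣ X ∣}} {{m^n≢0 n ∣ Y ∣}} (begin
    a ℕ.* n ^ ∣ Y ∣                       ≤⟨ *-monoˡ-≤ (n ^ ∣ Y ∣) a≤cnᶻ ⟩
    c ℕ.* n ^ ∣ Z ∣ ℕ.* n ^ ∣ Y ∣         ≡⟨ *-assoc c _ _ ⟩
    c ℕ.* (n ^ ∣ Z ∣ ℕ.* n ^ ∣ Y ∣)       ≡⟨ cong (c ℕ.*_) (*-comm (n ^ ∣ Z ∣) _) ⟩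
    c ℕ.* (n ^ ∣ Y ∣ ℕ.* n ^ ∣ Z ∣)       ≡⟨ cong (c ℕ.*_) (sym (pow-split s)) ⟩
    c ℕ.* n ^ ∣ X ∣                       ∎)
    where open ≤-Reasoning

  μ-as-ratio : (S : Subset k) (A : Rel n k) {X R : Subset k} →
    S ∩ dom A ≡ X → dom A ─ X ≡ R → μ S A ≡ ratio (maxFiber X R A) X
  μ-as-ratio S A refl refl = refl

  μ-sub : (A : Rel n k) {X : Subset k} → X ⊑ dom A → μ X A ≡ ratio (maxFiber X (dom A ─ X) A) X
  μ-sub A {X} X⊑V = μ-as-ratio X A (∩-absorb X⊑V) refl

  μ-co : (A : Rel n k) {X : Subset k} → X ⊑ dom A →
    μ (dom A ─ X) A ≡ ratio (maxFiber (dom A ─ X) X A) (dom A ─ X)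
  μ-co A {X} X⊑V = μ-as-ratio (dom A ─ X) A (∩-absorb (⊆⇒⊑ (p─q⊆p (dom A) X))) (─-─-absorb X⊑V)

  μ-shrink : (A : Rel n k) {S S⁺ : Subset k} → S ⊑ S⁺ → S⁺ ⊑ dom A → μ S⁺ A ≤ μ S A
  μ-shrink A {S} {S⁺} S⊑S⁺ S⁺⊑V =
    subst₂ _≤_ (sym (μ-sub A S⁺⊑V)) (sym (μ-sub A (⊑-trans S⊑S⁺ S⁺⊑V)))
      (ratio-≤-scaled (maxFiber S⁺ (dom A ─ S⁺) A) (maxFiber S (dom A ─ S) A)
                      (split-─ S⊑S⁺) (maxFiber-shrink A S⊑S⁺ S⁺⊑V))

  μ-≤-μ-proj : (A : Rel n k) {S S⁺ : Subset k} → S ⊑ S⁺ → S⁺ ⊑ dom A → μ S A ≤ μ S (proj S⁺ A)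
  μ-≤-μ-proj A {S} {S⁺} S⊑S⁺ S⁺⊑V =
    subst₂ _≤_ (sym (μ-sub A (⊑-trans S⊑S⁺ S⁺⊑V))) (sym (μ-sub (proj S⁺ A) S⊑S⁺))
      (ratio-mono (maxFiber S (dom A ─ S) A) (maxFiber S (S⁺ ─ S) (proj S⁺ A)) S
                  (maxFiber-≤-proj A S⊑S⁺ S⁺⊑V))

  μ-proj-≤-π : (A : Rel n k) {S S⁺ : Subset k} → S ⊑ S⁺ → μ S (proj S⁺ A) ≤ π S A
  μ-proj-≤-π A {S} {S⁺} S⊑S⁺ =
    subst (_≤ π S A) (sym (μ-sub (proj S⁺ A) S⊑S⁺))
      (ratio-mono (maxFiber S (S⁺ ─ S) (proj S⁺ A)) (card (proj S A)) S (maxFiber-proj-≤ A S⊑S⁺))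

  π-shrink : (A : Rel n k) {S⁻ S : Subset k} → S⁻ ⊑ S → π S A ≤ π S⁻ A
  π-shrink A {S⁻} {S} S⁻⊑S =
    ratio-≤-scaled (card (proj S A)) (card (proj S⁻ A)) (split-─ S⁻⊑S) (proj-shrink A S⁻⊑S)

  δ-≤-π*μ : (A : Rel n k) {S : Subset k} → S ⊑ dom A → δ A ≤ π S A * μ (dom A ─ S) A
  δ-≤-π*μ A {S} S⊑V = subst (δ A ≤_)
    (sym (trans (cong (π S A *_) (μ-co A S⊑V))
                (ratio-* (card (proj S A)) (maxFiber (dom A ─ S) S A) (split-─ S⊑V))))
    (ratio-mono (card A) (card (proj S A) ℕ.* maxFiber (dom A ─ S) S A) (dom A) (card-≤-proj*fiber A S⊑V))

  δ-join : (A B : Rel n k) {S T : Subset k} → S ⊑ dom A → T ⊑ dom B →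
    δ (join A B) ≤ (π S A * μ (T ─ S) (proj T B)) * μ ((dom A ∪ dom B) ─ (S ∪ T)) (join A B)
  δ-join A B {S} {T} S⊑V T⊑W = subst (δ (join A B) ≤_) (sym (begin
    (π S A * μ (T ─ S) (proj T B)) * μ (D ─ (S ∪ T)) (join A B)
      ≡⟨ cong₂ (λ x y → (π S A * x) * y) (μ-sub (proj T B) (⊆⇒⊑ (p─q⊆p T S))) (μ-co (join A B) S∪T⊑D) ⟩
    (ratio p S * ratio M₂ (T ─ S)) * ratio M₃ (D ─ (S ∪ T))
      ≡⟨ cong (_* ratio M₃ (D ─ (S ∪ T))) (ratio-* p M₂ (split-swap (split-∪ S T))) ⟩
    ratio (p ℕ.* M₂) (S ∪ T) * ratio M₃ (D ─ (S ∪ T))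
      ≡⟨ ratio-* (p ℕ.* M₂) M₃ (split-─ S∪T⊑D) ⟩
    ratio (p ℕ.* M₂ ℕ.* M₃) D ∎))
    (ratio-mono (card (join A B)) (p ℕ.* M₂ ℕ.* M₃) D (card-join A B S⊑V T⊑W))
    where
    open ≡-Reasoning
    D : Subset k
    D = dom A ∪ dom B
    S∪T⊑D : S ∪ T ⊑ D
    S∪T⊑D = ∪-mono S⊑V T⊑W
    p M₂ M₃ : ℕ
    p = card (proj S A)
    M₂ = maxFiber (T ─ S) (T ─ (T ─ S)) (proj T B)
    M₃ = maxFiber (D ─ (S ∪ T)) (S ∪ T) (join A B)

open import Defs
open import Data.Product using (_×_; _,_)
open import Data.Fin.Subset using (Subset; _⊆_; _∪_; _─_)
open import Data.Fin.Subset.Properties using (⊆-trans)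
open import Data.Rational using (_≤_; _*_)

lemma4p4 : {k : ℕ} (n : ℕ) .{{_ : NonZero n}}
    (A B : Rel n k) (S⁻ S S⁺ T : Subset k) →
    S⁻ ⊆ S → S ⊆ S⁺ → S⁺ ⊆ dom A → T ⊆ dom B →
    ((μ S⁺ A ≤ μ S A) × (μ S A ≤ μ S (proj S⁺ A)) × (μ S (proj S⁺ A) ≤ π S A) × (π S A ≤ π S⁻ A))
    × (δ A ≤ π S A * μ (dom A ─ S) A)
    × (δ (join A B) ≤ (π S A * μ (T ─ S) (proj T B)) * μ ((dom A ∪ dom B) ─ (S ∪ T)) (join A B))
lemma4p4 {k} n A B S⁻ S S⁺ T S⁻⊆S S⊆S⁺ S⁺⊆V T⊆W =
    (μ-shrink A S⊑S⁺ S⁺⊑V , μ-≤-μ-proj A S⊑S⁺ S⁺⊑V , μ-proj-≤-π A S⊑S⁺ , π-shrink A S⁻⊑S)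
  , δ-≤-π*μ A S⊑V
  , δ-join A B S⊑V T⊑W
  where
  open Subsets using (_⊑_; ⊆⇒⊑)
  open Densities {k} n
  S⁻⊑S : S⁻ ⊑ S
  S⁻⊑S = ⊆⇒⊑ S⁻⊆S
  S⊑S⁺ : S ⊑ S⁺
  S⊑S⁺ = ⊆⇒⊑ S⊆S⁺
  S⁺⊑V : S⁺ ⊑ dom A
  S⁺⊑V = ⊆⇒⊑ S⁺⊆V
  S⊑V : S ⊑ dom A
  S⊑V = ⊆⇒⊑ (⊆-trans S⊆S⁺ S⁺⊆V)
  T⊑W : T ⊑ dom B
  T⊑W = ⊆⇒⊑ T⊆W
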